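{- Let $(V,d)$ be a finite metric with $\mathsf{root}\in V$, let $B>0$, $\epsilon>0$, an integer $C\ge 1$, and independent random variables $X_v\in[0,1]$ for $v\in V$. Suppose tours $\pi_1,\dots,\pi_C$ originating at $\mathsf{root}$ are constructed sequentially as follows: for each $s$, with $\Pi^{(s-1)}=\pi_1\cup\dots\cup\pi_{s-1}$, the tour $\pi_s$ collects profit $\sum_{v\in\pi_s}w^{(s)}_v$ at least $\mathrm{OPT}_s-\epsilon$, where $w^{(s)}_v=\mathbb{E}[X_v]$ for $v\notin\Pi^{(s-1)}$ and $w^{(s)}_v=0$ for $v\in\Pi^{(s-1)}$, and $\mathrm{OPT}_s$ is the maximum of $\sum_{v\in\pi}w^{(s)}_v$ over tours $\pi$ from $\mathsf{root}$ of length at most $B$ (the tours $\pi_s$ themselves may be longer than $B$). Let $\Pi=\pi_1\cup\dots\cup\pi_C$ and let $T$ be the maximum of $\sum_{v\in\pi}\mathbb{E}[X_v]$ over tours $\pi\subseteq V\setminus\Pi$ from $\mathsf{root}$ of length at most $B$. Then for any adaptive strategy $\mathsf{ADAP}$ travelling total distance at most $B$ from $\mathsf{root}$, with $\Pi(\mathsf{ADAP})\subseteq\Pi$ the random set of vertices of $\Pi$ it visits, we have (with probability one) \[\sum_{v\in\Pi\setminus\Pi(\mathsf{ADAP})}\mathbb{E}[X_v]\ \ge\ (C-1)(T-\epsilon)-\epsilon.\]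
   Context: This formalizes the paper's subroutine which runs $C$ repetitions of a bi-criteria Orienteering algorithm with budget $B$, profits $\mathbb{E}[X_v]$ and additive error $\epsilon$, zeroing out profits of vertices found in earlier repetitions.
   Formalization: The distances of the metric, the budget $B$, the additive error $\epsilon$ and the means $\mathbb{E}[X_v]$ are rational. -}

module Defs where

open import Data.Nat using (ℕ; zero; suc; _<ᵇ_)
open import Data.Fin using (Fin; zero; suc; toℕ; _≟_)
open import Data.Bool using (Bool; true; false; if_then_else_; _∧_; _∨_; not)
open import Data.List using (List; []; _∷_; concatMap; allFin)
open import Data.Rational using (ℚ; 0ℚ; _+_; _≤_)
open import Relation.Binary.PropositionalEquality using (_≡_)
open import Relation.Nullary.Decidable using (⌊_⌋)

record FiniteMetric (n : ℕ) : Set where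
  field
    d       : Fin n → Fin n → ℚ
    d-refl  : ∀ v → d v v ≡ 0ℚ
    d-zero  : ∀ u v → d u v ≡ 0ℚ → u ≡ v
    d-sym   : ∀ u v → d u v ≡ d v u
    d-tri   : ∀ u v w → d u w ≤ d u v + d v w

-- A tour from the root is given by the list of vertices visited after the root.
-- Its length: d(root,v1) + d(v1,v2) + ... (a walk starting at x).
pathLen : ∀ {n} → (Fin n → Fin n → ℚ) → Fin n → List (Fin n) → ℚ
pathLen d x []       = 0ℚ
pathLen d x (y ∷ ys) = d x y + pathLen d y ys

mem : ∀ {n} → Fin n → List (Fin n) → Bool
mem v []       = false
mem v (u ∷ us) = ⌊ v ≟ u ⌋ ∨ mem v us

-- v is a (profit-carrying, i.e. non-root) vertex visited by the vertex list t.
visits : ∀ {n} → Fin n → List (Fin n) → Fin n → Bool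
visits root t v = not ⌊ v ≟ root ⌋ ∧ mem v t

sumFin : ∀ {n} → (Fin n → ℚ) → ℚ
sumFin {zero}  f = 0ℚ
sumFin {suc n} f = f zero + sumFin (λ i → f (suc i))

sumOver : ∀ {n} → (Fin n → Bool) → (Fin n → ℚ) → ℚ
sumOver P w = sumFin (λ v → if P v then w v else 0ℚ)

profit : ∀ {n} → Fin n → List (Fin n) → (Fin n → ℚ) → ℚ
profit root t w = sumOver (visits root t) w

-- Π^{(s-1)} = π_1 ∪ ... ∪ π_{s-1} (as a vertex list), for s : Fin C (0-indexed).
prevUnion : ∀ {n C} → (Fin C → List (Fin n)) → Fin C → List (Fin n)
prevUnion {C = C} π s = concatMap (λ j → if toℕ j <ᵇ toℕ s then π j else []) (allFin C)

allUnion : ∀ {n C} → (Fin C → List (Fin n)) → List (Fin n)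
allUnion {C = C} π = concatMap π (allFin C)

stageWeight : ∀ {n C} → Fin n → (Fin n → ℚ) → (Fin C → List (Fin n)) → Fin C → Fin n → ℚ
stageWeight root μ π s v = if visits root (prevUnion π s) v then 0ℚ else μ v

-- A vertex carries weight in stage s only if no earlier tour visited it, so it is paid for at
-- most once, by the first tour that visits it: the stage profits add up to exactly μ(Π), which is
-- at most μ(Π ∖ Π(ADAP)) + μ(Π(ADAP)).  Stage 1 still sees the weights μ, and ADAP is a
-- competitor of length ≤ B, so stage 1 earns at least μ(ADAP) − ε.  Each later stage sees the
-- full weights μ on the tour τ ⊆ V ∖ Π, a competitor as well, so it earns at least μ(τ) − ε.
-- Adding up, (C − 1)(μ(τ) − ε) + μ(ADAP) − ε ≤ μ(Π ∖ Π(ADAP)) + μ(ADAP).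
module Submission where

open import Defs
open import Data.Nat using (ℕ; zero; suc; _∸_; _<ᵇ_; s≤s; z≤n) renaming (_≤_ to _≤ℕ_)
open import Data.Fin using (Fin; zero; suc; toℕ; _≟_)
open import Data.Bool using (Bool; true; false; not; _∧_; _∨_; if_then_else_)
open import Data.Bool.Properties using (∨-assoc; ∨-conicalˡ; ∨-conicalʳ; ∧-conicalʳ; ∧-zeroʳ)
open import Data.List using (List; []; _∷_; _++_; concatMap; tabulate)
open import Data.List.Relation.Unary.All using (All; []; _∷_)
open import Data.Integer using (+_)
import Data.Integer as ℤ
import Data.Integer.Properties as ℤ
import Data.Nat.Coprimality as Coprimality
open import Data.Rational using (ℚ; 0ℚ; 1ℚ; _/_; _+_; _-_; -_; _*_; _≤_; _<_)
import Data.Rational.Properties as ℚ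
open import Data.Rational.Solver using (module +-*-Solver)
open +-*-Solver using (solve; _:+_; _:-_; _:*_; _:=_; con)
open import Algebra.Properties.CommutativeMonoid.Sum ℚ.+-0-commutativeMonoid
  using (sum; sum-cong-≗; sum-replicate-zero; ∑-distrib-+; ∑-comm)
open import Data.Product using (_×_; proj₁)
open import Data.Sum using (_⊎_; inj₁; inj₂)
open import Function using (id; _∘_)
open import Relation.Nullary using (yes; no)
open import Relation.Nullary.Decidable using (⌊_⌋; isYes≗does; dec-true)
open import Relation.Binary.PropositionalEquality using (_≡_; refl; sym; trans; cong; cong₂; subst; module ≡-Reasoning)

anyFin : ∀ {k} → (Fin k → Bool) → Bool
anyFin {zero}  b = false
anyFin {suc k} b = b zero ∨ anyFin (b ∘ suc)

anyBefore : ∀ {k} → (Fin k → Bool) → Fin k → Bool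
anyBefore b s = anyFin (λ j → (toℕ j <ᵇ toℕ s) ∧ b j)

anyFin-cong : ∀ {k} {b c : Fin k → Bool} → (∀ i → b i ≡ c i) → anyFin b ≡ anyFin c
anyFin-cong {zero}  eq = refl
anyFin-cong {suc k} eq = cong₂ _∨_ (eq zero) (anyFin-cong (eq ∘ suc))

anyFin-false : ∀ k → anyFin {k} (λ _ → false) ≡ false
anyFin-false zero    = refl
anyFin-false (suc k) = anyFin-false k

anyBefore-zero : ∀ {k} (b : Fin (suc k) → Bool) → anyBefore b zero ≡ false
anyBefore-zero {k} b = anyFin-false (suc k)

anyBefore-false : ∀ {k} (b : Fin k → Bool) s → anyFin b ≡ false → anyBefore b s ≡ false
anyBefore-false b zero    none = anyBefore-zero b
anyBefore-false b (suc s) none =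
  cong₂ _∨_ (∨-conicalˡ _ _ none) (anyBefore-false (b ∘ suc) s (∨-conicalʳ _ _ none))

∧-false-mono : ∀ r {a a′} → (a ≡ false → a′ ≡ false) → r ∧ a ≡ false → r ∧ a′ ≡ false
∧-false-mono false h none = refl
∧-false-mono true  h none = h none

mem-++ : ∀ {n} (v : Fin n) xs ys → mem v (xs ++ ys) ≡ mem v xs ∨ mem v ys
mem-++ v []       ys = refl
mem-++ v (u ∷ us) ys = trans (cong (⌊ v ≟ u ⌋ ∨_) (mem-++ v us ys)) (sym (∨-assoc ⌊ v ≟ u ⌋ _ _))

mem-concatMap-tabulate : ∀ {n k} {A : Set} (v : Fin n) (f : A → List (Fin n)) (g : Fin k → A) →
                         mem v (concatMap f (tabulate g)) ≡ anyFin (λ j → mem v (f (g j)))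
mem-concatMap-tabulate {k = zero}  v f g = refl
mem-concatMap-tabulate {k = suc k} v f g =
  trans (mem-++ v (f (g zero)) _) (cong (mem v (f (g zero)) ∨_) (mem-concatMap-tabulate v f (g ∘ suc)))

mem-if : ∀ {n} (v : Fin n) c xs → mem v (if c then xs else []) ≡ c ∧ mem v xs
mem-if v true  xs = refl
mem-if v false xs = refl

All-mem : ∀ {n} {P : Fin n → Set} {xs} → All P xs → ∀ v → mem v xs ≡ true → P v
All-mem {xs = u ∷ us} (pu ∷ pus) v v∈ with v ≟ u
... | yes refl = pu
... | no  _    = All-mem pus v v∈

visits-root : ∀ {n} (root : Fin n) t → visits root t root ≡ false
visits-root root t =
  cong (λ b → not b ∧ mem root t) (trans (isYes≗does (root ≟ root)) (dec-true (root ≟ root) refl))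

visits-All : ∀ {n} {root : Fin n} {Q : Fin n → Set} {xs} → All (λ v → v ≡ root ⊎ Q v) xs →
             ∀ v → visits root xs v ≡ true → Q v
visits-All {root = root} {xs = xs} all v visited with All-mem all v (∧-conicalʳ _ _ visited)
... | inj₂ q    = q
... | inj₁ refl with trans (sym visited) (visits-root root xs)
...   | ()

module _ {n C : ℕ} (π : Fin C → List (Fin n)) (v : Fin n) where

  mem-prevUnion : ∀ s → mem v (prevUnion π s) ≡ anyBefore (λ j → mem v (π j)) s
  mem-prevUnion s = trans (mem-concatMap-tabulate v earlier id) (anyFin-cong (λ j → mem-if v _ (π j)))
    where
    earlier : Fin C → List (Fin n)
    earlier j = if toℕ j <ᵇ toℕ s then π j else []

  mem-allUnion : mem v (allUnion π) ≡ anyFin (λ j → mem v (π j))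
  mem-allUnion = mem-concatMap-tabulate v π id

sumFin≡sum : ∀ {k} (f : Fin k → ℚ) → sumFin f ≡ sum f
sumFin≡sum {zero}  f = refl
sumFin≡sum {suc k} f = cong (_+_ (f zero)) (sumFin≡sum (f ∘ suc))

sumFin-cong : ∀ {k} {f g : Fin k → ℚ} → (∀ i → f i ≡ g i) → sumFin f ≡ sumFin g
sumFin-cong {zero}  eq = refl
sumFin-cong {suc k} eq = cong₂ _+_ (eq zero) (sumFin-cong (eq ∘ suc))

sumFin-mono : ∀ {k} {f g : Fin k → ℚ} → (∀ i → f i ≤ g i) → sumFin f ≤ sumFin g
sumFin-mono {zero}  le = ℚ.≤-refl
sumFin-mono {suc k} le = ℚ.+-mono-≤ (le zero) (sumFin-mono (le ∘ suc))

sumFin-zero : ∀ k → sumFin {k} (λ _ → 0ℚ) ≡ 0ℚ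
sumFin-zero k = trans (sumFin≡sum {k} (λ _ → 0ℚ)) (sum-replicate-zero k)

sumFin-+ : ∀ {k} (f g : Fin k → ℚ) → sumFin (λ i → f i + g i) ≡ sumFin f + sumFin g
sumFin-+ f g = trans (sumFin≡sum (λ i → f i + g i))
  (trans (∑-distrib-+ f g) (sym (cong₂ _+_ (sumFin≡sum f) (sumFin≡sum g))))

sumFin-comm : ∀ {k l} (f : Fin k → Fin l → ℚ) →
              sumFin (λ i → sumFin (f i)) ≡ sumFin (λ j → sumFin (λ i → f i j))
sumFin-comm f = begin
  sumFin (λ i → sumFin (f i))         ≡⟨ sumFin≡sum (λ i → sumFin (f i)) ⟩
  sum (λ i → sumFin (f i))            ≡⟨ sum-cong-≗ (λ i → sumFin≡sum (f i)) ⟩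
  sum (λ i → sum (f i))               ≡⟨ ∑-comm f ⟩
  sum (λ j → sum (λ i → f i j))       ≡⟨ sum-cong-≗ (λ j → sumFin≡sum (λ i → f i j)) ⟨
  sum (λ j → sumFin (λ i → f i j))    ≡⟨ sumFin≡sum (λ j → sumFin (λ i → f i j)) ⟨
  sumFin (λ j → sumFin (λ i → f i j)) ∎
  where open ≡-Reasoning

1+[k/1]≡[1+k]/1 : ∀ k → 1ℚ + + k / 1 ≡ + suc k / 1
1+[k/1]≡[1+k]/1 k = trans (cong (_+_ 1ℚ) (ℚ.normalize-coprime (Coprimality.sym (Coprimality.1-coprimeTo k))))
                          (cong (λ i → (+ 1 ℤ.+ i) / 1) (ℤ.*-identityʳ (+ k)))

sumFin-const : ∀ k x → sumFin {k} (λ _ → x) ≡ (+ k / 1) * x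
sumFin-const zero    x = sym (ℚ.*-zeroˡ x)
sumFin-const (suc k) x = begin
  x + sumFin {k} (λ _ → x)   ≡⟨ cong (_+_ x) (sumFin-const k x) ⟩
  x + (+ k / 1) * x          ≡⟨ solve 2 (λ x q → x :+ q :* x := (con 1ℚ :+ q) :* x) refl x (+ k / 1) ⟩
  (1ℚ + + k / 1) * x         ≡⟨ cong (_* x) (1+[k/1]≡[1+k]/1 k) ⟩
  (+ suc k / 1) * x          ∎
  where open ≡-Reasoning

firstVisit-if : ∀ b a (m : ℚ) → (if b then (if a then 0ℚ else m) else 0ℚ) ≡ (if not a ∧ b then m else 0ℚ)
firstVisit-if true  true  m = refl
firstVisit-if true  false m = refl
firstVisit-if false true  m = refl
firstVisit-if false false m = refl

sumFin-firstVisit : ∀ {k} (b : Fin k → Bool) (m : ℚ) →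
                    sumFin (λ s → if not (anyBefore b s) ∧ b s then m else 0ℚ)
                      ≡ (if anyFin b then m else 0ℚ)
sumFin-firstVisit {zero}  b m = refl
sumFin-firstVisit {suc k} b m =
  trans (cong₂ _+_ (cong (λ a → if not a ∧ b zero then m else 0ℚ) (anyBefore-zero b)) refl) (split (b zero))
  where
  split : ∀ c → (if c then m else 0ℚ)
                  + sumFin (λ i → if not (c ∨ anyBefore (b ∘ suc) i) ∧ b (suc i) then m else 0ℚ)
                ≡ (if c ∨ anyFin (b ∘ suc) then m else 0ℚ)
  split true  = trans (cong (_+_ m) (sumFin-zero k)) (ℚ.+-identityʳ m)
  split false = trans (ℚ.+-identityˡ _) (sumFin-firstVisit (b ∘ suc) m)

if-then-cong : ∀ b {x y : ℚ} → (b ≡ true → x ≡ y) → (if b then x else 0ℚ) ≡ (if b then y else 0ℚ)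
if-then-cong true  eq = eq refl
if-then-cong false eq = refl

sumOver-cong : ∀ {n} (P : Fin n → Bool) {w w′ : Fin n → ℚ} →
               (∀ v → P v ≡ true → w v ≡ w′ v) → sumOver P w ≡ sumOver P w′
sumOver-cong P eq = sumFin-cong (λ v → if-then-cong (P v) (eq v))

sumOver-split : ∀ {n} (P Q : Fin n → Bool) {w : Fin n → ℚ} → (∀ v → 0ℚ ≤ w v) →
                sumOver P w ≤ sumOver (λ v → P v ∧ not (Q v)) w + sumOver Q w
sumOver-split P Q {w} w≥0 =
  ℚ.≤-trans (sumFin-mono (λ v → split (P v) (Q v) (w≥0 v))) (ℚ.≤-reflexive (sumFin-+ onlyP onQ))
  where
  onlyP onQ : Fin _ → ℚ
  onlyP v = if P v ∧ not (Q v) then w v else 0ℚ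
  onQ   v = if Q v then w v else 0ℚ
  split : ∀ p q {x} → 0ℚ ≤ x → (if p then x else 0ℚ) ≤ (if p ∧ not q then x else 0ℚ) + (if q then x else 0ℚ)
  split true  true  {x} _   = ℚ.≤-reflexive (sym (ℚ.+-identityˡ x))
  split true  false {x} _   = ℚ.≤-reflexive (sym (ℚ.+-identityʳ x))
  split false true  {x} x≥0 = ℚ.≤-trans x≥0 (ℚ.≤-reflexive (sym (ℚ.+-identityˡ x)))
  split false false     _   = ℚ.≤-refl

module Stages {n C : ℕ} (root : Fin n) (μ : Fin n → ℚ) (π : Fin C → List (Fin n)) where

  W : Fin C → Fin n → ℚ
  W = stageWeight root μ π

  stageProfits-at : ∀ v → sumFin (λ s → if visits root (π s) v then W s v else 0ℚ)
                          ≡ (if visits root (allUnion π) v then μ v else 0ℚ)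
  stageProfits-at v = atVertex (not ⌊ v ≟ root ⌋)
    where
    -- visits root t v unfolds to not ⌊ v ≟ root ⌋ ∧ mem v t; abstracting that flag lets both cases compute.
    b : Fin C → Bool
    b s = mem v (π s)
    atVertex : ∀ r → sumFin (λ s → if r ∧ b s then (if r ∧ mem v (prevUnion π s) then 0ℚ else μ v) else 0ℚ)
                     ≡ (if r ∧ mem v (allUnion π) then μ v else 0ℚ)
    atVertex false = sumFin-zero C
    atVertex true  = begin
      sumFin (λ s → if b s then (if mem v (prevUnion π s) then 0ℚ else μ v) else 0ℚ)
        ≡⟨ sumFin-cong paidAtFirstVisit ⟩
      sumFin (λ s → if not (anyBefore b s) ∧ b s then μ v else 0ℚ)
        ≡⟨ sumFin-firstVisit b (μ v) ⟩
      (if anyFin b then μ v else 0ℚ)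
        ≡⟨ cong (if_then μ v else 0ℚ) (mem-allUnion π v) ⟨
      (if mem v (allUnion π) then μ v else 0ℚ) ∎
      where
      open ≡-Reasoning
      paidAtFirstVisit : ∀ s → (if b s then (if mem v (prevUnion π s) then 0ℚ else μ v) else 0ℚ)
                               ≡ (if not (anyBefore b s) ∧ b s then μ v else 0ℚ)
      paidAtFirstVisit s = trans (cong (λ a → if b s then (if a then 0ℚ else μ v) else 0ℚ) (mem-prevUnion π v s))
                                 (firstVisit-if (b s) _ (μ v))

  sum-stageProfits : sumFin (λ s → profit root (π s) (W s)) ≡ sumOver (visits root (allUnion π)) μ
  sum-stageProfits =
    trans (sumFin-comm (λ s v → if visits root (π s) v then W s v else 0ℚ)) (sumFin-cong stageProfits-at)

  stageWeight-outside : ∀ s v → visits root (allUnion π) v ≡ false → W s v ≡ μ v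
  stageWeight-outside s v unvisited =
    cong (if_then 0ℚ else μ v) (∧-false-mono (not ⌊ v ≟ root ⌋) earlier unvisited)
    where
    earlier : mem v (allUnion π) ≡ false → mem v (prevUnion π s) ≡ false
    earlier none = trans (mem-prevUnion π v s)
      (anyBefore-false (λ j → mem v (π j)) s (trans (sym (mem-allUnion π v)) none))

stageWeight-zero : ∀ {n C} (root : Fin n) μ (π : Fin (suc C) → List (Fin n)) v →
                   stageWeight root μ π zero v ≡ μ v
stageWeight-zero root μ π v =
  cong (if_then 0ℚ else μ v) (trans (cong (not ⌊ v ≟ root ⌋ ∧_) nothingEarlier) (∧-zeroʳ _))
  where
  nothingEarlier : mem v (prevUnion π zero) ≡ false
  nothingEarlier = trans (mem-prevUnion π v zero) (anyBefore-zero (λ j → mem v (π j)))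

a-e≤p∧p+y≤g+a⇒y-e≤g : ∀ {a e p y g : ℚ} → a - e ≤ p → p + y ≤ g + a → y - e ≤ g
a-e≤p∧p+y≤g+a⇒y-e≤g {a} {e} {p} {y} {g} a-e≤p p+y≤g+a = begin
  y - e               ≡⟨ solve 3 (λ a e y → y :- e := ((a :- e) :+ y) :- a) refl a e y ⟩
  ((a - e) + y) - a   ≤⟨ ℚ.+-monoˡ-≤ (- a) (ℚ.≤-trans (ℚ.+-monoˡ-≤ y a-e≤p) p+y≤g+a) ⟩
  (g + a) - a         ≡⟨ solve 2 (λ g a → (g :+ a) :- a := g) refl g a ⟩
  g                   ∎
  where open ℚ.≤-Reasoning

lemma3p3 : ∀ {n : ℕ} (M : FiniteMetric n) (root : Fin n) (B ε : ℚ) → 0ℚ < B → 0ℚ < ε →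
           (C : ℕ) → 1 ≤ℕ C →
           (μ : Fin n → ℚ) → (∀ v → (0ℚ ≤ μ v) × (μ v ≤ 1ℚ)) →
           (π : Fin C → List (Fin n)) →
           (∀ (s : Fin C) (σ : List (Fin n)) → pathLen (FiniteMetric.d M) root σ ≤ B →
             profit root σ (stageWeight root μ π s) - ε ≤ profit root (π s) (stageWeight root μ π s)) →
           ∀ (τ : List (Fin n)) → pathLen (FiniteMetric.d M) root τ ≤ B →
           All (λ v → (v ≡ root) ⊎ (visits root (allUnion π) v ≡ false)) τ →
           ∀ (adap : List (Fin n)) → pathLen (FiniteMetric.d M) root adap ≤ B →
           ((+ (C ∸ 1)) / 1) * (profit root τ μ - ε) - ε
             ≤ sumOver (λ v → visits root (allUnion π) v ∧ not (visits root adap v)) μ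
lemma3p3 M root B ε _ _ (suc C′) (s≤s z≤n) μ μ∈[0,1] π stageBound τ τ≤B τ∩Π=∅ adap adap≤B =
  ℚ.≤-trans (ℚ.+-monoˡ-≤ (- ε) laterStages) (a-e≤p∧p+y≤g+a⇒y-e≤g firstStage allStages)
  where
  open Stages root μ π
  P : Fin (suc C′) → ℚ
  P s = profit root (π s) (W s)
  firstStage : profit root adap μ - ε ≤ P zero
  firstStage = subst (λ x → x - ε ≤ P zero)
    (sumOver-cong (visits root adap) (λ v _ → stageWeight-zero root μ π v)) (stageBound zero adap adap≤B)
  laterStage : ∀ i → profit root τ μ - ε ≤ P (suc i)
  laterStage i = subst (λ x → x - ε ≤ P (suc i))
    (sumOver-cong (visits root τ) (λ v visited → stageWeight-outside (suc i) v (visits-All τ∩Π=∅ v visited)))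
    (stageBound (suc i) τ τ≤B)
  laterStages : (+ C′ / 1) * (profit root τ μ - ε) ≤ sumFin (P ∘ suc)
  laterStages = ℚ.≤-trans (ℚ.≤-reflexive (sym (sumFin-const C′ _))) (sumFin-mono laterStage)
  allStages : P zero + sumFin (P ∘ suc)
              ≤ sumOver (λ v → visits root (allUnion π) v ∧ not (visits root adap v)) μ + profit root adap μ
  allStages = ℚ.≤-trans (ℚ.≤-reflexive sum-stageProfits)
    (sumOver-split (visits root (allUnion π)) (visits root adap) (λ v → proj₁ (μ∈[0,1] v)))
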